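{- Let $a,b,c$ be positive integers such that $\sqrt{ab} = k_c\sqrt{c}$, $\sqrt{ac}=k_b\sqrt{b}$ and $\sqrt{bc}=k_a\sqrt{a}$ for some positive integers $k_a,k_b,k_c$. Then the quadratic form $x^2+ay^2+bz^2+cw^2$ is norm quaternionic; specifically, the $\mathbb{Z}$-module $\mathbb{Z}[1,\sqrt{a}\,\mathbf{i},\sqrt{b}\,\mathbf{j},\sqrt{c}\,\mathbf{k}]$ is closed under quaternion multiplication, and $x^2+ay^2+bz^2+cw^2 = N(x+y\sqrt{a}\,\mathbf{i}+z\sqrt{b}\,\mathbf{j}+w\sqrt{c}\,\mathbf{k})$.
   Context: Real quaternions are $a_1+a_2\mathbf{i}+a_3\mathbf{j}+a_4\mathbf{k}$ with $a_t\in\mathbb{R}$, where $\mathbf{i}^2=\mathbf{j}^2=\mathbf{k}^2=\mathbf{i}\mathbf{j}\mathbf{k}=-1$; the norm is $N(a_1+a_2\mathbf{i}+a_3\mathbf{j}+a_4\mathbf{k})=a_1^2+a_2^2+a_3^2+a_4^2$. For quaternions $\mathbf{g}_1,\dots,\mathbf{g}_4$, $\mathbb{Z}[\mathbf{g}_1,\dots,\mathbf{g}_4]$ denotes the $\mathbb{Z}$-module of all integer linear combinations of them. A quadratic form $f(x,y,z,w)$ is called norm quaternionic if there are quaternions $\mathbf{g}_1,\dots,\mathbf{g}_4$ such that $\mathbb{Z}[\mathbf{g}_1,\dots,\mathbf{g}_4]$ is closed under quaternion multiplication and $f(x,y,z,w)=N(x\mathbf{g}_1+y\mathbf{g}_2+z\mathbf{g}_3+w\mathbf{g}_4)$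 for all integers $x,y,z,w$. -}

module Defs where

open import Level using (_⊔_)
open import Data.Nat using (ℕ; zero; suc)
open import Data.Integer as ℤ using (ℤ; +_; -[1+_])
open import Data.Product using (Σ; _×_; _,_)
open import Algebra.Bundles using (CommutativeRing)

module Quat {c ℓ} (R : CommutativeRing c ℓ) where
  open CommutativeRing R public

  record Quaternion : Set c where
    constructor quat
    field
      q₁ q₂ q₃ q₄ : Carrier
  open Quaternion public

  _≈Q_ : Quaternion → Quaternion → Set ℓ
  p ≈Q q = (q₁ p ≈ q₁ q) × (q₂ p ≈ q₂ q) × (q₃ p ≈ q₃ q) × (q₄ p ≈ q₄ q)

  -- Hamilton product (i² = j² = k² = ijk = -1)
  _*Q_ : Quaternion → Quaternion → Quaternion
  quat a₁ a₂ a₃ a₄ *Q quat b₁ b₂ b₃ b₄ = quat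
    (a₁ * b₁ - a₂ * b₂ - a₃ * b₃ - a₄ * b₄)
    (a₁ * b₂ + a₂ * b₁ + a₃ * b₄ - a₄ * b₃)
    (a₁ * b₃ - a₂ * b₄ + a₃ * b₁ + a₄ * b₂)
    (a₁ * b₄ + a₂ * b₃ - a₃ * b₂ + a₄ * b₁)

  _+Q_ : Quaternion → Quaternion → Quaternion
  quat a₁ a₂ a₃ a₄ +Q quat b₁ b₂ b₃ b₄ = quat (a₁ + b₁) (a₂ + b₂) (a₃ + b₃) (a₄ + b₄)

  N : Quaternion → Carrier
  N (quat a₁ a₂ a₃ a₄) = a₁ * a₁ + a₂ * a₂ + a₃ * a₃ + a₄ * a₄

  fromℕ : ℕ → Carrier
  fromℕ zero = 0#
  fromℕ (suc n) = 1# + fromℕ n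

  fromℤ : ℤ → Carrier
  fromℤ (+ n) = fromℕ n
  fromℤ -[1+ n ] = - fromℕ (suc n)

  _·Q_ : ℤ → Quaternion → Quaternion
  n ·Q quat a₁ a₂ a₃ a₄ = quat (fromℤ n * a₁) (fromℤ n * a₂) (fromℤ n * a₃) (fromℤ n * a₄)

  comb : (g₁ g₂ g₃ g₄ : Quaternion) → ℤ → ℤ → ℤ → ℤ → Quaternion
  comb g₁ g₂ g₃ g₄ x y z w = (((x ·Q g₁) +Q (y ·Q g₂)) +Q (z ·Q g₃)) +Q (w ·Q g₄)

  MulClosed : (g₁ g₂ g₃ g₄ : Quaternion) → Set ℓ
  MulClosed g₁ g₂ g₃ g₄ =
    ∀ x y z w x' y' z' w' →
      Σ ℤ λ x'' → Σ ℤ λ y'' → Σ ℤ λ z'' → Σ ℤ λ w'' →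
        (comb g₁ g₂ g₃ g₄ x y z w *Q comb g₁ g₂ g₃ g₄ x' y' z' w')
          ≈Q comb g₁ g₂ g₃ g₄ x'' y'' z'' w''

  NormQuaternionicVia : (ℤ → ℤ → ℤ → ℤ → ℤ) → (g₁ g₂ g₃ g₄ : Quaternion) → Set ℓ
  NormQuaternionicVia f g₁ g₂ g₃ g₄ =
    MulClosed g₁ g₂ g₃ g₄ ×
    (∀ x y z w → N (comb g₁ g₂ g₃ g₄ x y z w) ≈ fromℤ (f x y z w))

  NormQuaternionic : (ℤ → ℤ → ℤ → ℤ → ℤ) → Set (c ⊔ ℓ)
  NormQuaternionic f =
    Σ Quaternion λ g₁ → Σ Quaternion λ g₂ → Σ Quaternion λ g₃ → Σ Quaternion λ g₄ →
      NormQuaternionicVia f g₁ g₂ g₃ g₄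

diagForm : ℕ → ℕ → ℕ → ℤ → ℤ → ℤ → ℤ → ℤ
diagForm a b c x y z w =
  x ℤ.* x ℤ.+ + a ℤ.* (y ℤ.* y) ℤ.+ + b ℤ.* (z ℤ.* z) ℤ.+ + c ℤ.* (w ℤ.* w)

-- Products of the basis vectors 1, √a i, √b j, √c k are again integer combinations of them:
-- (√a i)² = -a and (√a i)(√b j) = -(√b j)(√a i) = √a √b k = k_c √c k, and cyclically. Hence the
-- product of X + Y √a i + Z √b j + W √c k and X' + Y' √a i + Z' √b j + W' √c k has the same shape,
-- with coordinates that are integer polynomials in X, …, W', and the norm of X + Y √a i + Z √b j + W √c k
-- is X² + a Y² + b Z² + c W².
module Submission where

open import Defs
open import Level using (Level)
open import Data.Nat as ℕ using (ℕ; _>_; zero; suc)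
import Data.Nat.Properties as ℕP
open import Data.Integer as ℤ using (ℤ; +_; -[1+_]; _⊖_)
import Data.Integer.Properties as ℤP
open import Data.Maybe using (map)
open import Data.Product using (_×_; _,_)
open import Function using (_∘_)
open import Relation.Binary.PropositionalEquality as ≡ using (_≡_; cong)
open import Relation.Nullary.Decidable using (dec⇒maybe)
open import Relation.Binary.Bundles using (Setoid)
open import Algebra.Bundles using (CommutativeRing)
import Algebra.Solver.Ring
import Algebra.Solver.Ring.AlmostCommutativeRing as ACR
import Algebra.Properties.Ring as RingProperties
import Algebra.Properties.AbelianGroup as AbelianGroupProperties
import Algebra.Properties.CommutativeSemigroup as CommutativeSemigroupProperties

-- Coordinates of the product of X + Y √a i + Z √b j + W √c k and X' + Y' √a i + Z' √b j + W' √c k,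
-- where A, B, C stand for a, b, c: re is the real one, and im K_a X Y Z W X' Y' Z' W' the i-coordinate;
-- the j- and k-coordinates are im with i, j, k permuted cyclically.
module ProductCoordinates {c ℓ} (S : CommutativeRing c ℓ) where
  open CommutativeRing S

  re : (A B C X Y Z W X' Y' Z' W' : Carrier) → Carrier
  re A B C X Y Z W X' Y' Z' W' = X * X' - A * (Y * Y') - B * (Z * Z') - C * (W * W')

  im : (K X U V T X' U' V' T' : Carrier) → Carrier
  im K X U V T X' U' V' T' = X * U' + U * X' + K * (V * T' - T * V')

module ℤ-Coordinates = ProductCoordinates ℤP.+-*-commutativeRing

module IntegerEmbedding {c ℓ} (R : CommutativeRing c ℓ) where
  open Quat R
  open ProductCoordinates R
  open RingProperties ring using (-‿involutive; -0#≈0#; -‿distribˡ-*)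
  open AbelianGroupProperties +-abelianGroup using (⁻¹-∙-comm)
  open CommutativeSemigroupProperties +-commutativeSemigroup using (interchange)
  open import Relation.Binary.Reasoning.Setoid setoid

  fromℕ-+ : ∀ m n → fromℕ (m ℕ.+ n) ≈ fromℕ m + fromℕ n
  fromℕ-+ zero n = sym (+-identityˡ _)
  fromℕ-+ (suc m) n = trans (+-congˡ (fromℕ-+ m n)) (sym (+-assoc _ _ _))

  fromℤ-neg : ∀ i → fromℤ (ℤ.- i) ≈ - fromℤ i
  fromℤ-neg (+ zero) = sym -0#≈0#
  fromℤ-neg (+ suc n) = refl
  fromℤ-neg -[1+ n ] = sym (-‿involutive _)

  fromℤ-⊖ : ∀ m n → fromℤ (m ⊖ n) ≈ fromℕ m - fromℕ n
  fromℤ-⊖ m zero = sym (trans (+-congˡ -0#≈0#) (+-identityʳ _))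
  fromℤ-⊖ zero (suc n) = sym (+-identityˡ _)
  fromℤ-⊖ (suc m) (suc n) = begin
    fromℤ (suc m ⊖ suc n)                   ≈⟨ reflexive (cong fromℤ (ℤP.[1+m]⊖[1+n]≡m⊖n m n)) ⟩
    fromℤ (m ⊖ n)                           ≈⟨ fromℤ-⊖ m n ⟩
    fromℕ m - fromℕ n                       ≈⟨ +-identityˡ _ ⟨
    0# + (fromℕ m - fromℕ n)                ≈⟨ +-congʳ (-‿inverseʳ 1#) ⟨
    (1# - 1#) + (fromℕ m - fromℕ n)         ≈⟨ interchange 1# (- 1#) (fromℕ m) (- fromℕ n) ⟩
    (1# + fromℕ m) + (- 1# - fromℕ n)       ≈⟨ +-congˡ (⁻¹-∙-comm 1# (fromℕ n)) ⟩
    fromℕ (suc m) - fromℕ (suc n)           ∎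

  fromℤ-+ : ∀ i j → fromℤ (i ℤ.+ j) ≈ fromℤ i + fromℤ j
  fromℤ-+ (+ m) (+ n) = fromℕ-+ m n
  fromℤ-+ (+ m) -[1+ n ] = fromℤ-⊖ m (suc n)
  fromℤ-+ -[1+ m ] (+ n) = trans (fromℤ-⊖ n (suc m)) (+-comm _ _)
  fromℤ-+ -[1+ m ] -[1+ n ] = begin
    - fromℕ (suc (suc (m ℕ.+ n)))         ≈⟨ -‿cong (reflexive (cong (fromℕ ∘ suc) (≡.sym (ℕP.+-suc m n)))) ⟩
    - fromℕ (suc m ℕ.+ suc n)             ≈⟨ -‿cong (fromℕ-+ (suc m) (suc n)) ⟩
    - (fromℕ (suc m) + fromℕ (suc n))     ≈⟨ ⁻¹-∙-comm (fromℕ (suc m)) (fromℕ (suc n)) ⟨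
    - fromℕ (suc m) + - fromℕ (suc n)     ∎

  fromℤ-*⁺ : ∀ n j → fromℤ (+ n ℤ.* j) ≈ fromℕ n * fromℤ j
  fromℤ-*⁺ zero j = sym (zeroˡ _)
  fromℤ-*⁺ (suc n) j = begin
    fromℤ (+ suc n ℤ.* j)              ≈⟨ reflexive (cong fromℤ (ℤP.suc-* (+ n) j)) ⟩
    fromℤ (j ℤ.+ + n ℤ.* j)            ≈⟨ fromℤ-+ j (+ n ℤ.* j) ⟩
    fromℤ j + fromℤ (+ n ℤ.* j)        ≈⟨ +-cong (sym (*-identityˡ _)) (fromℤ-*⁺ n j) ⟩
    1# * fromℤ j + fromℕ n * fromℤ j   ≈⟨ distribʳ (fromℤ j) 1# (fromℕ n) ⟨
    (1# + fromℕ n) * fromℤ j           ∎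

  fromℤ-* : ∀ i j → fromℤ (i ℤ.* j) ≈ fromℤ i * fromℤ j
  fromℤ-* (+ n) j = fromℤ-*⁺ n j
  fromℤ-* -[1+ n ] j = begin
    fromℤ (-[1+ n ] ℤ.* j)             ≈⟨ reflexive (cong fromℤ (≡.sym (ℤP.neg-distribˡ-* (+ suc n) j))) ⟩
    fromℤ (ℤ.- (+ suc n ℤ.* j))        ≈⟨ fromℤ-neg (+ suc n ℤ.* j) ⟩
    - fromℤ (+ suc n ℤ.* j)            ≈⟨ -‿cong (fromℤ-*⁺ (suc n) j) ⟩
    - (fromℕ (suc n) * fromℤ j)        ≈⟨ -‿distribˡ-* (fromℕ (suc n)) (fromℤ j) ⟩
    - fromℕ (suc n) * fromℤ j          ∎

  fromℤ-morphism : ACR._-Raw-AlmostCommutative⟶_ ℤ.+-*-rawRing (ACR.fromCommutativeRing R)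
  fromℤ-morphism = record
    { ⟦_⟧ = fromℤ ; +-homo = fromℤ-+ ; *-homo = fromℤ-* ; -‿homo = fromℤ-neg
    ; 0-homo = refl ; 1-homo = +-identityʳ 1# }

  module Solver = Algebra.Solver.Ring ℤ.+-*-rawRing (ACR.fromCommutativeRing R) fromℤ-morphism
    (λ i j → map (reflexive ∘ cong fromℤ) (dec⇒maybe (i ℤ.≟ j)))

  -- The integers are explicit arguments below: fromℤ is not injective, so they cannot be inferred.
  infix 4 _↦_
  _↦_ : ℤ → Carrier → Set ℓ
  i ↦ r = fromℤ i ≈ r

  ↦-+ : ∀ i j {r s} → i ↦ r → j ↦ s → i ℤ.+ j ↦ r + s
  ↦-+ i j i↦r j↦s = trans (fromℤ-+ i j) (+-cong i↦r j↦s)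

  ↦-sub : ∀ i j {r s} → i ↦ r → j ↦ s → i ℤ.- j ↦ r - s
  ↦-sub i j i↦r j↦s = ↦-+ i (ℤ.- j) i↦r (trans (fromℤ-neg j) (-‿cong j↦s))

  ↦-* : ∀ i j {r s} → i ↦ r → j ↦ s → i ℤ.* j ↦ r * s
  ↦-* i j i↦r j↦s = trans (fromℤ-* i j) (*-cong i↦r j↦s)

  ↦-*-* : ∀ i j k → i ℤ.* (j ℤ.* k) ↦ fromℤ i * (fromℤ j * fromℤ k)
  ↦-*-* i j k = ↦-* i (j ℤ.* k) refl (fromℤ-* j k)

  fromℤ-re : ∀ A B C X Y Z W X' Y' Z' W' →
    ℤ-Coordinates.re A B C X Y Z W X' Y' Z' W' ↦
    re (fromℤ A) (fromℤ B) (fromℤ C) (fromℤ X) (fromℤ Y) (fromℤ Z) (fromℤ W) (fromℤ X') (fromℤ Y') (fromℤ Z') (fromℤ W')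
  fromℤ-re A B C X Y Z W X' Y' Z' W' =
    ↦-sub (X ℤ.* X' ℤ.- A ℤ.* (Y ℤ.* Y') ℤ.- B ℤ.* (Z ℤ.* Z')) (C ℤ.* (W ℤ.* W'))
      (↦-sub (X ℤ.* X' ℤ.- A ℤ.* (Y ℤ.* Y')) (B ℤ.* (Z ℤ.* Z'))
        (↦-sub (X ℤ.* X') (A ℤ.* (Y ℤ.* Y')) (fromℤ-* X X') (↦-*-* A Y Y'))
        (↦-*-* B Z Z'))
      (↦-*-* C W W')

  fromℤ-im : ∀ K X U V T X' U' V' T' →
    ℤ-Coordinates.im K X U V T X' U' V' T' ↦
    im (fromℤ K) (fromℤ X) (fromℤ U) (fromℤ V) (fromℤ T) (fromℤ X') (fromℤ U') (fromℤ V') (fromℤ T')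
  fromℤ-im K X U V T X' U' V' T' =
    ↦-+ (X ℤ.* U' ℤ.+ U ℤ.* X') (K ℤ.* (V ℤ.* T' ℤ.- T ℤ.* V'))
      (↦-+ (X ℤ.* U') (U ℤ.* X') (fromℤ-* X U') (fromℤ-* U X'))
      (↦-* K (V ℤ.* T' ℤ.- T ℤ.* V') refl (↦-sub (V ℤ.* T') (T ℤ.* V') (fromℤ-* V T') (fromℤ-* T V')))

  fromℤ-diagForm : ∀ a b c x y z w →
    diagForm a b c x y z w ↦
    fromℤ x * fromℤ x + fromℕ a * (fromℤ y * fromℤ y) + fromℕ b * (fromℤ z * fromℤ z) + fromℕ c * (fromℤ w * fromℤ w)
  fromℤ-diagForm a b c x y z w =
    ↦-+ (x ℤ.* x ℤ.+ + a ℤ.* (y ℤ.* y) ℤ.+ + b ℤ.* (z ℤ.* z)) (+ c ℤ.* (w ℤ.* w))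
      (↦-+ (x ℤ.* x ℤ.+ + a ℤ.* (y ℤ.* y)) (+ b ℤ.* (z ℤ.* z))
        (↦-+ (x ℤ.* x) (+ a ℤ.* (y ℤ.* y)) (fromℤ-* x x) (↦-*-* (+ a) y y))
        (↦-*-* (+ b) z z))
      (↦-*-* (+ c) w w)

module QuaternionProperties {c ℓ} (R : CommutativeRing c ℓ) where
  open Quat R

  ≈Q-setoid : Setoid c ℓ
  ≈Q-setoid = record
    { Carrier = Quaternion
    ; _≈_ = _≈Q_
    ; isEquivalence = record
      { refl = refl , refl , refl , refl
      ; sym = λ (p₁ , p₂ , p₃ , p₄) → sym p₁ , sym p₂ , sym p₃ , sym p₄
      ; trans = λ (p₁ , p₂ , p₃ , p₄) (q₁ , q₂ , q₃ , q₄) → trans p₁ q₁ , trans p₂ q₂ , trans p₃ q₃ , trans p₄ q₄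
      }
    }

  -‿cong₂ : ∀ {x x' y y'} → x ≈ x' → y ≈ y' → x - y ≈ x' - y'
  -‿cong₂ x≈x' y≈y' = +-cong x≈x' (-‿cong y≈y')

  *Q-cong : ∀ {p p' q q'} → p ≈Q p' → q ≈Q q' → (p *Q q) ≈Q (p' *Q q')
  *Q-cong {quat _ _ _ _} {quat _ _ _ _} {quat _ _ _ _} {quat _ _ _ _} (p₁ , p₂ , p₃ , p₄) (q₁ , q₂ , q₃ , q₄) =
    -‿cong₂ (-‿cong₂ (-‿cong₂ (*-cong p₁ q₁) (*-cong p₂ q₂)) (*-cong p₃ q₃)) (*-cong p₄ q₄) ,
    -‿cong₂ (+-cong (+-cong (*-cong p₁ q₂) (*-cong p₂ q₁)) (*-cong p₃ q₄)) (*-cong p₄ q₃) ,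
    +-cong (+-cong (-‿cong₂ (*-cong p₁ q₃) (*-cong p₂ q₄)) (*-cong p₃ q₁)) (*-cong p₄ q₂) ,
    +-cong (-‿cong₂ (+-cong (*-cong p₁ q₄) (*-cong p₂ q₃)) (*-cong p₃ q₂)) (*-cong p₄ q₁)

  N-cong : ∀ {p q} → p ≈Q q → N p ≈ N q
  N-cong {quat _ _ _ _} {quat _ _ _ _} (p₁ , p₂ , p₃ , p₄) =
    +-cong (+-cong (+-cong (*-cong p₁ p₁) (*-cong p₂ p₂)) (*-cong p₃ p₃)) (*-cong p₄ p₄)

module ScaledProducts {c ℓ} (R : CommutativeRing c ℓ) where
  open CommutativeRing R
  open ProductCoordinates R
  open IntegerEmbedding R using (module Solver)
  open Solver using (solve; _:=_; _:+_; _:-_; _:*_)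

  scaled-square : ∀ {u A} Y Y' → u * u ≈ A → (Y * u) * (Y' * u) ≈ A * (Y * Y')
  scaled-square {u} Y Y' u²≈A =
    trans (solve 3 (λ Y Y' u → (Y :* u) :* (Y' :* u) := (u :* u) :* (Y :* Y')) refl Y Y' u) (*-congʳ u²≈A)

  im-scaled : ∀ {u v t K} X U V T X' U' V' T' → v * t ≈ K * u →
    X * (U' * u) + (U * u) * X' + (V * v) * (T' * t) - (T * t) * (V' * v) ≈ im K X U V T X' U' V' T' * u
  im-scaled {u} {v} {t} {K} X U V T X' U' V' T' vt≈Ku = begin
    X * (U' * u) + (U * u) * X' + (V * v) * (T' * t) - (T * t) * (V' * v)
      ≈⟨ solve 11 (λ X U V T X' U' V' T' u v t →
           X :* (U' :* u) :+ (U :* u) :* X' :+ (V :* v) :* (T' :* t) :- (T :* t) :* (V' :* v) :=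
           (X :* U' :+ U :* X') :* u :+ (V :* T' :- T :* V') :* (v :* t)) refl X U V T X' U' V' T' u v t ⟩
    (X * U' + U * X') * u + (V * T' - T * V') * (v * t)
      ≈⟨ +-congˡ (*-congˡ vt≈Ku) ⟩
    (X * U' + U * X') * u + (V * T' - T * V') * (K * u)
      ≈⟨ solve 4 (λ P Q K u → P :* u :+ Q :* (K :* u) := (P :+ K :* Q) :* u) refl
           (X * U' + U * X') (V * T' - T * V') K u ⟩
    im K X U V T X' U' V' T' * u ∎
    where open import Relation.Binary.Reasoning.Setoid setoid

module _ {c ℓ} (R : CommutativeRing c ℓ) where
  open Quat R

  module DiagonalBasis
    (√a √b √c A B C Ka Kb Kc : Carrier)
    (√a² : √a * √a ≈ A) (√b² : √b * √b ≈ B) (√c² : √c * √c ≈ C)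
    (√a√b : √a * √b ≈ Kc * √c) (√a√c : √a * √c ≈ Kb * √b) (√b√c : √b * √c ≈ Ka * √a) where
    open ProductCoordinates R
    open IntegerEmbedding R using (module Solver)
    open Solver using (Polynomial; solve; _:=_; _:+_; _:-_; con)
    open QuaternionProperties R using (-‿cong₂)
    open ScaledProducts R

    g₁ g₂ g₃ g₄ : Quaternion
    g₁ = quat 1# 0# 0# 0#
    g₂ = quat 0# √a 0# 0#
    g₃ = quat 0# 0# √b 0#
    g₄ = quat 0# 0# 0# √c

    diag : (X Y Z W : Carrier) → Quaternion
    diag X Y Z W = quat X (Y * √a) (Z * √b) (W * √c)

    diag-cong : ∀ {X Y Z W X' Y' Z' W'} → X ≈ X' → Y ≈ Y' → Z ≈ Z' → W ≈ W' → diag X Y Z W ≈Q diag X' Y' Z' W'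
    diag-cong X≈X' Y≈Y' Z≈Z' W≈W' = X≈X' , *-congʳ Y≈Y' , *-congʳ Z≈Z' , *-congʳ W≈W'

    comb-diag : ∀ x y z w → comb g₁ g₂ g₃ g₄ x y z w ≈Q diag (fromℤ x) (fromℤ y) (fromℤ z) (fromℤ w)
    comb-diag x y z w =
      trans (sum-cong (*-identityʳ _) (zeroʳ _) (zeroʳ _) (zeroʳ _)) (solve 1 (λ t → t :+ 𝟎 :+ 𝟎 :+ 𝟎 := t) refl _) ,
      trans (sum-cong (zeroʳ _) refl (zeroʳ _) (zeroʳ _)) (solve 1 (λ t → 𝟎 :+ t :+ 𝟎 :+ 𝟎 := t) refl _) ,
      trans (sum-cong (zeroʳ _) (zeroʳ _) refl (zeroʳ _)) (solve 1 (λ t → 𝟎 :+ 𝟎 :+ t :+ 𝟎 := t) refl _) ,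
      trans (sum-cong (zeroʳ _) (zeroʳ _) (zeroʳ _) refl) (solve 1 (λ t → 𝟎 :+ 𝟎 :+ 𝟎 :+ t := t) refl _)
      where
      𝟎 : Polynomial 1
      𝟎 = con (+ 0)
      sum-cong : ∀ {p q r s p' q' r' s'} → p ≈ p' → q ≈ q' → r ≈ r' → s ≈ s' → p + q + r + s ≈ p' + q' + r' + s'
      sum-cong p≈p' q≈q' r≈r' s≈s' = +-cong (+-cong (+-cong p≈p' q≈q') r≈r') s≈s'

    diag-*Q : ∀ X Y Z W X' Y' Z' W' →
      (diag X Y Z W *Q diag X' Y' Z' W') ≈Q
      diag (re A B C X Y Z W X' Y' Z' W') (im Ka X Y Z W X' Y' Z' W') (im Kb X Z W Y X' Z' W' Y') (im Kc X W Y Z X' W' Y' Z')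
    diag-*Q X Y Z W X' Y' Z' W' =
      -‿cong₂ (-‿cong₂ (-‿cong₂ refl (scaled-square Y Y' √a²)) (scaled-square Z Z' √b²)) (scaled-square W W' √c²) ,
      im-scaled X Y Z W X' Y' Z' W' √b√c ,
      trans (solve 4 (λ p q r s → p :- q :+ r :+ s := p :+ r :+ s :- q) refl _ _ _ _)
        (im-scaled X Z W Y X' Z' W' Y' (trans (*-comm √c √a) √a√c)) ,
      trans (solve 4 (λ p q r s → p :+ q :- r :+ s := p :+ s :+ q :- r) refl _ _ _ _)
        (im-scaled X W Y Z X' W' Y' Z' √a√b)

    N-diag : ∀ X Y Z W → N (diag X Y Z W) ≈ X * X + A * (Y * Y) + B * (Z * Z) + C * (W * W)
    N-diag X Y Z W = +-cong (+-cong (+-congˡ (scaled-square Y Y √a²)) (scaled-square Z Z √b²)) (scaled-square W W √c²)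

  module _
    (a b c ka kb kc : ℕ) (√a √b √c : Carrier)
    (√a² : √a * √a ≈ fromℕ a) (√b² : √b * √b ≈ fromℕ b) (√c² : √c * √c ≈ fromℕ c)
    (√a√b : √a * √b ≈ fromℕ kc * √c) (√a√c : √a * √c ≈ fromℕ kb * √b) (√b√c : √b * √c ≈ fromℕ ka * √a) where
    open IntegerEmbedding R using (fromℤ-re; fromℤ-im; fromℤ-diagForm)
    open QuaternionProperties R using (≈Q-setoid; *Q-cong; N-cong)
    open DiagonalBasis √a √b √c (fromℕ a) (fromℕ b) (fromℕ c) (fromℕ ka) (fromℕ kb) (fromℕ kc) √a² √b² √c² √a√b √a√c √b√c
    private module Q = Setoid ≈Q-setoid

    diagForm-normQuaternionic : NormQuaternionicVia (diagForm a b c) g₁ g₂ g₃ g₄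
    diagForm-normQuaternionic = mulClosed , norm
      where
      mulClosed : MulClosed g₁ g₂ g₃ g₄
      mulClosed x y z w x' y' z' w' = x'' , y'' , z'' , w'' ,
        Q.trans (*Q-cong (comb-diag x y z w) (comb-diag x' y' z' w'))
          (Q.trans (diag-*Q X Y Z W X' Y' Z' W')
            (Q.sym (Q.trans (comb-diag x'' y'' z'' w'')
              (diag-cong (fromℤ-re (+ a) (+ b) (+ c) x y z w x' y' z' w') (fromℤ-im (+ ka) x y z w x' y' z' w')
                         (fromℤ-im (+ kb) x z w y x' z' w' y') (fromℤ-im (+ kc) x w y z x' w' y' z')))))
        where
        open ℤ-Coordinates
        x'' y'' z'' w'' : ℤ
        x'' = re (+ a) (+ b) (+ c) x y z w x' y' z' w'
        y'' = im (+ ka) x y z w x' y' z' w'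
        z'' = im (+ kb) x z w y x' z' w' y'
        w'' = im (+ kc) x w y z x' w' y' z'
        X Y Z W X' Y' Z' W' : Carrier
        X = fromℤ x ; Y = fromℤ y ; Z = fromℤ z ; W = fromℤ w
        X' = fromℤ x' ; Y' = fromℤ y' ; Z' = fromℤ z' ; W' = fromℤ w'

      norm : ∀ x y z w → N (comb g₁ g₂ g₃ g₄ x y z w) ≈ fromℤ (diagForm a b c x y z w)
      norm x y z w =
        trans (N-cong (comb-diag x y z w)) (trans (N-diag _ _ _ _) (sym (fromℤ-diagForm a b c x y z w)))

lemma1 : ∀ {ℓc ℓe : Level} (R : CommutativeRing ℓc ℓe) →
    let open Quat R in
    (a b c ka kb kc : ℕ) →
    a > 0 → b > 0 → c > 0 → ka > 0 → kb > 0 → kc > 0 →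
    a ℕ.* b ≡ kc ℕ.* kc ℕ.* c → a ℕ.* c ≡ kb ℕ.* kb ℕ.* b → b ℕ.* c ≡ ka ℕ.* ka ℕ.* a →
    (√a √b √c : Carrier) →
    √a * √a ≈ fromℕ a → √b * √b ≈ fromℕ b → √c * √c ≈ fromℕ c →
    √a * √b ≈ fromℕ kc * √c → √a * √c ≈ fromℕ kb * √b → √b * √c ≈ fromℕ ka * √a →
    NormQuaternionicVia (diagForm a b c)
    (quat 1# 0# 0# 0#) (quat 0# √a 0# 0#) (quat 0# 0# √b 0#) (quat 0# 0# 0# √c)
    × NormQuaternionic (diagForm a b c)
-- Positivity and the integer relations ab = k_c² c, … are unused: they follow from the relations
-- among √a, √b, √c when R is ℝ, and only the latter enter the computation.
lemma1 R a b c ka kb kc _ _ _ _ _ _ _ _ _ √a √b √c √a² √b² √c² √a√b √a√c √b√c =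
  via , (_ , _ , _ , _ , via)
  where
  open Quat R
  via : NormQuaternionicVia (diagForm a b c) (quat 1# 0# 0# 0#) (quat 0# √a 0# 0#) (quat 0# 0# √b 0#) (quat 0# 0# 0# √c)
  via = diagForm-normQuaternionic R a b c ka kb kc √a √b √c √a² √b² √c² √a√b √a√c √b√c
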